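{- Let $n\geq 1$. Let $a_1(n)$ be the number of partitions $\lambda$ of $n$ satisfying the following: - the set of even parts of $\lambda$ has exactly one element, $2^k m$, with $k\ge 1$ and $m$ odd; - $2^k m$ occurs in $\lambda$ with odd multiplicity; - $m$ is a part of $\lambda$ with multiplicity between $1$ and $2^k-1$ inclusive. Let $c_1(n)$ be the number of partitions of $n$ in which one part occurs exactly three times and all other parts occur exactly once. Then $a_1(n)=c_1(n)$.
   Context: A partition of $n$ is a non-increasing sequence of positive integers (its parts) summing to $n$. -}

module Defs where

open import Data.Nat using (ℕ; zero; suc; _+_; _*_; _∸_; _^_; _≤_; _<_; _≥_; _≟_)
open import Data.Nat.DivMod using (_%_)
open import Data.Nat.ListAction using (sum)
open import Data.List using (List; []; _∷_)
open import Data.List.Relation.Unary.All using (All)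
open import Data.List.Relation.Unary.Linked using (Linked)
open import Data.Product using (Σ; _×_)
open import Data.Sum using (_⊎_)
open import Relation.Binary.PropositionalEquality using (_≡_)
open import Relation.Nullary using (yes; no)

-- Parity (stdlib has no Odd predicate on ℕ); proof-irrelevant as an equation in ℕ.
Odd : ℕ → Set
Odd n = n % 2 ≡ 1

IsPartition : ℕ → List ℕ → Set
IsPartition n λs = Linked _≥_ λs × All (λ p → 0 < p) λs × sum λs ≡ n

mult : ℕ → List ℕ → ℕ
mult x [] = 0
mult x (p ∷ λs) with p ≟ x
... | yes _ = suc (mult x λs)
... | no  _ = mult x λs

A₁ : List ℕ → Set
A₁ λs = Σ ℕ λ k → Σ ℕ λ m →
          1 ≤ k × Odd m
        × All (λ p → Odd p ⊎ p ≡ 2 ^ k * m) λs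
        × Odd (mult (2 ^ k * m) λs)
        × 1 ≤ mult m λs × mult m λs ≤ 2 ^ k ∸ 1

C₁ : List ℕ → Set
C₁ λs = Σ ℕ λ p → mult p λs ≡ 3 × All (λ q → q ≡ p ⊎ mult q λs ≡ 1) λs

A₁-Partitions : ℕ → Set
A₁-Partitions n = Σ (List ℕ) λ λs → IsPartition n λs × A₁ λs

C₁-Partitions : ℕ → Set
C₁-Partitions n = Σ (List ℕ) λ λs → IsPartition n λs × C₁ λs

-- Group the parts of a partition by their odd part o, and let units o be the number of copies
-- of o the class would split into (a part o * 2 ^ i counts 2 ^ i).  A partition in A₁ with
-- parameters k, m is determined by these numbers, since its class m consists of c copies of m
-- and j copies of 2 ^ k * m with c < 2 ^ k, i.e. c and j are the remainder and quotient of
-- units m by 2 ^ k.  A partition in C₁ whose triple part is p is determined by p and these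
-- numbers too: after removing two copies of p its parts are distinct, so every class is the
-- binary expansion of its units.
-- The map A₁ → C₁ writes every class o ≠ m in binary.  For class m it takes a with
-- 2 ^ a ≤ c < 2 ^ (a + 1) and writes units m = c + j * 2 ^ k as N + 2 ^ (a + 1), where N
-- still has binary digit a; the binary expansion of N plus two more copies of p = m * 2 ^ a
-- gives p multiplicity three.  The inverse reads m, a off p and recovers c, j, k by dividing
-- units m by 2 ^ (a + 1).  Both maps preserve all units and the parameters are recovered, so
-- the two determination results make them mutually inverse.
module Submission where

open import Defs
open import Data.Nat using (ℕ; _≤_)
open import Function.Bundles using (_↔_)

open import Function.Bundles using (mk↔ₛ′)
open import Data.Nat
open import Data.Nat.Properties
open import Data.Nat.DivMod
open import Data.Nat.Divisibility using (divides)
open import Data.Nat.Tactic.RingSolver using (solve-∀)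
open import Data.Product using (∃; _×_; _,_; proj₁; proj₂)
import Data.Product as Product
open import Data.Sum using (_⊎_; inj₁; inj₂)
open import Function using (_∘_; id)
open import Relation.Nullary using (¬_; Dec; yes; no; contradiction)
open import Relation.Binary.PropositionalEquality
open import Relation.Binary.Definitions using (tri<; tri≈; tri>)
open import Data.List using (List; []; _∷_; _++_; replicate; map)
open import Data.List.Properties using (map-++)
open import Data.Nat.ListAction using (sum)
open import Data.Nat.ListAction.Properties using (sum-++; sum-↭)
open import Data.List.Relation.Unary.All as All using (All; []; _∷_)
open import Data.List.Relation.Unary.All.Properties using () renaming (++⁺ to All-++⁺; replicate⁺ to All-replicate⁺)
open import Data.List.Relation.Unary.AllPairs using (AllPairs; []; _∷_)
open import Data.List.Relation.Unary.Linked as Linked using (Linked)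
open import Data.List.Relation.Unary.Linked.Properties using (Linked⇒AllPairs)
open import Data.List.Relation.Binary.Permutation.Propositional as ↭ using (_↭_)
import Data.List.Relation.Binary.Permutation.Propositional.Properties as ↭
open import Relation.Binary.Properties.DecTotalOrder ≤-decTotalOrder using (≥-decTotalOrder)
open import Data.List.Sort ≥-decTotalOrder using (sort; sort-↗; sort-↭)

Odd? : ∀ o → Dec (Odd o)
Odd? o = o % 2 ≟ 1

Odd⇒1≤ : ∀ {o} → Odd o → 1 ≤ o
Odd⇒1≤ {suc _} _ = s≤s z≤n

¬Odd-*2 : ∀ m → ¬ Odd (m * 2)
¬Odd-*2 m odd = 0≢1+n (trans (sym (m*n%n≡0 m 2)) odd)

¬Odd-*2^suc : ∀ o i → ¬ Odd (o * 2 ^ suc i)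
¬Odd-*2^suc o i = ¬Odd-*2 (o * 2 ^ i) ∘ subst Odd (reorder o (2 ^ i))
  where
  reorder : ∀ a b → a * (2 * b) ≡ a * b * 2
  reorder = solve-∀

¬Odd-2^* : ∀ {k} m → 1 ≤ k → ¬ Odd (2 ^ k * m)
¬Odd-2^* {suc k} m _ = ¬Odd-*2^suc m k ∘ subst Odd (*-comm (2 ^ suc k) m)

2^>0 : ∀ i → 0 < 2 ^ i
2^>0 = m^n>0 2

2^-mono-≤ : ∀ {i j} → i ≤ j → 2 ^ i ≤ 2 ^ j
2^-mono-≤ = ^-monoʳ-≤ 2

2^suc≡2^+2^ : ∀ i → 2 ^ suc i ≡ 2 ^ i + 2 ^ i
2^suc≡2^+2^ i = cong (2 ^ i +_) (+-identityʳ (2 ^ i))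

[r+2*q]/2≡r/2+q : ∀ r q → (r + 2 * q) / 2 ≡ r / 2 + q
[r+2*q]/2≡r/2+q r q = begin
  (r + 2 * q) / 2     ≡⟨ cong (λ z → (r + z) / 2) (*-comm 2 q) ⟩
  (r + q * 2) / 2     ≡⟨ +-distrib-/-∣ʳ r (divides q refl) ⟩
  r / 2 + q * 2 / 2   ≡⟨ cong (r / 2 +_) (m*n/n≡m q 2) ⟩
  r / 2 + q           ∎
  where open ≡-Reasoning

[r+2*q]%2≡r%2 : ∀ r q → (r + 2 * q) % 2 ≡ r % 2
[r+2*q]%2≡r%2 r q = trans (cong (λ z → (r + z) % 2) (*-comm 2 q)) ([m+kn]%n≡m%n r q 2)

divMod-unique : ∀ {d r r′ q q′} → r < d → r′ < d → r + d * q ≡ r′ + d * q′ → r ≡ r′ × q ≡ q′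
divMod-unique {d} {r} {r′} {q} {q′} r<d r′<d eq = remainders , quotients
  where
  instance _ = >-nonZero (≤-trans (s≤s z≤n) r<d)
  remainder : ∀ {s} p → s < d → (s + d * p) % d ≡ s
  remainder {s} p s<d = trans (cong (λ z → (s + z) % d) (*-comm d p)) (trans ([m+kn]%n≡m%n s p d) (m<n⇒m%n≡m s<d))
  remainders : r ≡ r′
  remainders = trans (sym (remainder q r<d)) (trans (cong (_% d) eq) (remainder q′ r′<d))
  quotient : ∀ {s} p → s < d → (s + d * p) / d ≡ p
  quotient {s} p s<d = begin
    (s + d * p) / d   ≡⟨ cong (λ z → (s + z) / d) (*-comm d p) ⟩
    (s + p * d) / d   ≡⟨ +-distrib-/-∣ʳ s (divides p refl) ⟩
    s / d + p * d / d ≡⟨ cong₂ _+_ (m<n⇒m/n≡0 s<d) (m*n/n≡m p d) ⟩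
    p                 ∎
    where open ≡-Reasoning
  quotients : q ≡ q′
  quotients = trans (sym (quotient q r<d)) (trans (cong (_/ d) eq) (quotient q′ r′<d))

private
  twoAdic : ℕ → ℕ → ℕ × ℕ
  twoAdic zero       x = x , 0
  twoAdic (suc fuel) x with x % 2
  ... | zero  = Product.map₂ suc (twoAdic fuel (x / 2))
  ... | suc _ = x , 0

  twoAdic-spec : ∀ fuel x → 1 ≤ x → x ≤ fuel →
    Odd (proj₁ (twoAdic fuel x)) × proj₁ (twoAdic fuel x) * 2 ^ proj₂ (twoAdic fuel x) ≡ x
  twoAdic-spec zero (suc _) _ ()
  twoAdic-spec (suc fuel) x 1≤x x≤fuel with x % 2 in x%2 | m%n<n x 2
  ... | suc zero | _ = x%2 , *-identityʳ x
  ... | suc (suc _) | s≤s (s≤s ())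
  ... | zero     | _ = odd , (begin
      o * (2 * 2 ^ i) ≡⟨ reorder o (2 ^ i) ⟩
      2 * (o * 2 ^ i) ≡⟨ cong (2 *_) o*2^i≡h ⟩
      2 * h           ≡⟨ x≡2*h ⟨
      x               ∎)
    where
    open ≡-Reasoning
    reorder : ∀ a b → a * (2 * b) ≡ 2 * (a * b)
    reorder = solve-∀
    h = x / 2
    x≡2*h : x ≡ 2 * h
    x≡2*h = trans (m≡m%n+[m/n]*n x 2) (trans (cong (_+ h * 2) x%2) (*-comm h 2))
    1≤h : 1 ≤ h
    1≤h = m≥n⇒m/n>0 {x} {2} (≤∧≢⇒< 1≤x (λ x≡1 → 0≢1+n (trans (sym x%2) (cong (_% 2) (sym x≡1)))))
    h≤fuel : h ≤ fuel
    h≤fuel = ≤-pred (≤-trans (m/n<m x 2 {{>-nonZero 1≤x}} (s≤s (s≤s z≤n))) x≤fuel)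
    o = proj₁ (twoAdic fuel h)
    i = proj₂ (twoAdic fuel h)
    odd = proj₁ (twoAdic-spec fuel h 1≤h h≤fuel)
    o*2^i≡h = proj₂ (twoAdic-spec fuel h 1≤h h≤fuel)

oddPart : ℕ → ℕ
oddPart x = proj₁ (twoAdic x x)

ν₂ : ℕ → ℕ
ν₂ x = proj₂ (twoAdic x x)

oddPart-odd : ∀ {x} → 1 ≤ x → Odd (oddPart x)
oddPart-odd {x} 1≤x = proj₁ (twoAdic-spec x x 1≤x ≤-refl)

oddPart*2^ν₂ : ∀ {x} → 1 ≤ x → oddPart x * 2 ^ ν₂ x ≡ x
oddPart*2^ν₂ {x} 1≤x = proj₂ (twoAdic-spec x x 1≤x ≤-refl)

*2^-injective : ∀ {o o′} i i′ → Odd o → Odd o′ → o * 2 ^ i ≡ o′ * 2 ^ i′ → o ≡ o′ × i ≡ i′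
*2^-injective {o} {o′} zero zero _ _ eq =
  trans (sym (*-identityʳ o)) (trans eq (*-identityʳ o′)) , refl
*2^-injective {o} {o′} zero (suc i′) odd _ eq =
  contradiction (subst Odd (trans (sym (*-identityʳ o)) eq) odd) (¬Odd-*2^suc o′ i′)
*2^-injective {o} {o′} (suc i) zero _ odd′ eq =
  contradiction (subst Odd (trans (sym (*-identityʳ o′)) (sym eq)) odd′) (¬Odd-*2^suc o i)
*2^-injective {o} {o′} (suc i) (suc i′) odd odd′ eq =
  Product.map₂ (cong suc) (*2^-injective i i′ odd odd′ (*-cancelˡ-≡ _ _ 2 halved))
  where
  reorder : ∀ a b → a * (2 * b) ≡ 2 * (a * b)
  reorder = solve-∀
  halved : 2 * (o * 2 ^ i) ≡ 2 * (o′ * 2 ^ i′)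
  halved = trans (sym (reorder o (2 ^ i))) (trans eq (reorder o′ (2 ^ i′)))

Odd-*2^⇒1≤ : ∀ o i → Odd o → 1 ≤ o * 2 ^ i
Odd-*2^⇒1≤ o i odd = *-mono-≤ (Odd⇒1≤ {o} odd) (2^>0 i)

oddPart,ν₂-*2^ : ∀ o i → Odd o → oddPart (o * 2 ^ i) ≡ o × ν₂ (o * 2 ^ i) ≡ i
oddPart,ν₂-*2^ o i odd = *2^-injective (ν₂ (o * 2 ^ i)) i (oddPart-odd 1≤x) odd (oddPart*2^ν₂ 1≤x)
  where 1≤x = Odd-*2^⇒1≤ o i odd

oddPart-*2^ : ∀ o i → Odd o → oddPart (o * 2 ^ i) ≡ o
oddPart-*2^ o i odd = proj₁ (oddPart,ν₂-*2^ o i odd)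

ν₂-*2^ : ∀ o i → Odd o → ν₂ (o * 2 ^ i) ≡ i
ν₂-*2^ o i odd = proj₂ (oddPart,ν₂-*2^ o i odd)

oddPart-of-odd : ∀ o → Odd o → oddPart o ≡ o
oddPart-of-odd o odd = subst (λ x → oddPart x ≡ o) (*-identityʳ o) (oddPart-*2^ o 0 odd)

oddPart≤ : ∀ {x} → 1 ≤ x → oddPart x ≤ x
oddPart≤ {x} 1≤x = subst (oddPart x ≤_) (oddPart*2^ν₂ 1≤x) (m≤m*n (oddPart x) (2 ^ ν₂ x) {{m^n≢0 2 (ν₂ x)}})

<⇒≤∸1 : ∀ {c n} → c < n → c ≤ n ∸ 1
<⇒≤∸1 {n = suc n} (s≤s c≤n) = c≤n

≤∸1⇒< : ∀ {c n} → 1 ≤ n → c ≤ n ∸ 1 → c < n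
≤∸1⇒< {n = suc n} _ c≤n = s≤s c≤n

2^-cancel-< : ∀ {i j} → 2 ^ i < 2 ^ j → i < j
2^-cancel-< 2^i<2^j = ≰⇒> (<⇒≱ 2^i<2^j ∘ 2^-mono-≤)

magnitude : ∀ c → 1 ≤ c → ∃ λ a → 2 ^ a ≤ c × c < 2 ^ suc a
magnitude (suc zero)    _ = 0 , s≤s z≤n , s≤s (s≤s z≤n)
magnitude (suc (suc c)) _ with magnitude (suc c) (s≤s z≤n)
... | a , lower , upper with suc (suc c) <? 2 ^ suc a
...   | yes below = a , m≤n⇒m≤1+n lower , below
...   | no  notBelow = suc a , ≤-reflexive (sym c+2≡2^[1+a]) , (begin-strict
        suc (suc c)           ≡⟨ c+2≡2^[1+a] ⟩
        2 ^ suc a             <⟨ m<m+n (2 ^ suc a) (2^>0 (suc a)) ⟩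
        2 ^ suc a + 2 ^ suc a ≡⟨ 2^suc≡2^+2^ (suc a) ⟨
        2 ^ suc (suc a)       ∎)
  where
  open ≤-Reasoning
  c+2≡2^[1+a] : suc (suc c) ≡ 2 ^ suc a
  c+2≡2^[1+a] = ≤-antisym upper (≮⇒≥ notBelow)

magnitude-unique : ∀ {a b c} → 2 ^ a ≤ c → c < 2 ^ suc a → 2 ^ b ≤ c → c < 2 ^ suc b → a ≡ b
magnitude-unique lowerᵃ upperᵃ lowerᵇ upperᵇ = ≤-antisym
  (≤-pred (2^-cancel-< (≤-<-trans lowerᵃ upperᵇ)))
  (≤-pred (2^-cancel-< (≤-<-trans lowerᵇ upperᵃ)))

δ : ℕ → ℕ → ℕ
δ y x with y ≟ x
... | yes _ = 1
... | no  _ = 0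

δ-refl : ∀ x → δ x x ≡ 1
δ-refl x with x ≟ x
... | yes _ = refl
... | no x≢x = contradiction refl x≢x

δ-≢ : ∀ {y x} → y ≢ x → δ y x ≡ 0
δ-≢ {y} {x} y≢x with y ≟ x
... | yes y≡x = contradiction y≡x y≢x
... | no  _   = refl

δ-suc : ∀ y x → δ (suc y) (suc x) ≡ δ y x
δ-suc y x with y ≟ x
... | yes refl = δ-refl (suc y)
... | no  y≢x  = δ-≢ (y≢x ∘ suc-injective)

bit : ℕ → ℕ → ℕ
bit zero    T = T % 2
bit (suc i) T = bit i (T / 2)

bit≤1 : ∀ i T → bit i T ≤ 1
bit≤1 zero    T = ≤-pred (m%n<n T 2)
bit≤1 (suc i) T = bit≤1 i (T / 2)

private
  /2<2^ : ∀ {r} i → r < 2 ^ suc i → r / 2 < 2 ^ i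
  /2<2^ {r} i r< = m<n*o⇒m/o<n (subst (r <_) (*-comm 2 (2 ^ i)) r<)

bit-[r+2^i*h] : ∀ i {r} h → r < 2 ^ i → bit i (r + 2 ^ i * h) ≡ h % 2
bit-[r+2^i*h] zero    {zero} h _ = cong (_% 2) (+-identityʳ h)
bit-[r+2^i*h] zero    {suc _} h (s≤s ())
bit-[r+2^i*h] (suc i) {r}    h r< = begin
  bit i ((r + 2 ^ suc i * h) / 2)   ≡⟨ cong (λ z → bit i ((r + z) / 2)) (*-assoc 2 (2 ^ i) h) ⟩
  bit i ((r + 2 * (2 ^ i * h)) / 2) ≡⟨ cong (bit i) ([r+2*q]/2≡r/2+q r (2 ^ i * h)) ⟩
  bit i (r / 2 + 2 ^ i * h)         ≡⟨ bit-[r+2^i*h] i h (/2<2^ i r<) ⟩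
  h % 2                             ∎
  where open ≡-Reasoning

bit-< : ∀ i {T} → T < 2 ^ i → bit i T ≡ 0
bit-< i {T} T< = subst (λ z → bit i z ≡ 0) T+0≡T (bit-[r+2^i*h] i 0 T<)
  where T+0≡T = trans (cong (T +_) (*-zeroʳ (2 ^ i))) (+-identityʳ T)

bit-0 : ∀ t → bit t 0 ≡ 0
bit-0 t = bit-< t (2^>0 t)

bit-[r+2^suc[i]*q] : ∀ i r q → bit i (r + 2 ^ suc i * q) ≡ bit i r
bit-[r+2^suc[i]*q] zero    r q = [r+2*q]%2≡r%2 r q
bit-[r+2^suc[i]*q] (suc i) r q = begin
  bit i ((r + 2 ^ suc (suc i) * q) / 2)   ≡⟨ cong (λ z → bit i ((r + z) / 2)) (*-assoc 2 (2 ^ suc i) q) ⟩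
  bit i ((r + 2 * (2 ^ suc i * q)) / 2)   ≡⟨ cong (bit i) ([r+2*q]/2≡r/2+q r (2 ^ suc i * q)) ⟩
  bit i (r / 2 + 2 ^ suc i * q)           ≡⟨ bit-[r+2^suc[i]*q] i (r / 2) q ⟩
  bit i (r / 2)                           ∎
  where open ≡-Reasoning

bit-[r+2^d] : ∀ i d {r} → r < 2 ^ d → bit i (r + 2 ^ d) ≡ δ d i + bit i r
bit-[r+2^d] zero    zero    {zero} _  = refl
bit-[r+2^d] (suc i) zero    {zero} _  = refl
bit-[r+2^d] _       zero    {suc _} (s≤s ())
bit-[r+2^d] zero    (suc d) {r}    _  = [r+2*q]%2≡r%2 r (2 ^ d)
bit-[r+2^d] (suc i) (suc d) {r}    r< = begin
  bit i ((r + 2 * 2 ^ d) / 2)  ≡⟨ cong (bit i) ([r+2*q]/2≡r/2+q r (2 ^ d)) ⟩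
  bit i (r / 2 + 2 ^ d)        ≡⟨ bit-[r+2^d] i d (/2<2^ d r<) ⟩
  δ d i + bit i (r / 2)        ≡⟨ cong (_+ bit i (r / 2)) (δ-suc d i) ⟨
  δ (suc d) (suc i) + bit i (r / 2) ∎
  where open ≡-Reasoning

bit-leading : ∀ {a c} → 2 ^ a ≤ c → c < 2 ^ suc a → bit a c ≡ 1
bit-leading {a} {c} lower upper = subst (λ z → bit a z ≡ 1) c≡r+2^a (bit-[r+2^i*h] a 1 r<2^a)
  where
  r = c ∸ 2 ^ a
  c≡r+2^a : r + 2 ^ a * 1 ≡ c
  c≡r+2^a = trans (cong (r +_) (*-identityʳ (2 ^ a))) (m∸n+n≡m lower)
  r<2^a : r < 2 ^ a
  r<2^a = +-cancelˡ-< (2 ^ a) r (2 ^ a)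
    (subst₂ _<_ (sym (m+[n∸m]≡n lower)) (2^suc≡2^+2^ a) upper)

mult-∷ : ∀ x y L → mult x (y ∷ L) ≡ δ y x + mult x L
mult-∷ x y L with y ≟ x
... | yes _ = refl
... | no  _ = refl

mult-∷-self : ∀ x L → mult x (x ∷ L) ≡ suc (mult x L)
mult-∷-self x L = trans (mult-∷ x x L) (cong (_+ mult x L) (δ-refl x))

mult-∷-≢ : ∀ {x y} L → y ≢ x → mult x (y ∷ L) ≡ mult x L
mult-∷-≢ {x} {y} L y≢x = trans (mult-∷ x y L) (cong (_+ mult x L) (δ-≢ y≢x))

mult-++ : ∀ x A B → mult x (A ++ B) ≡ mult x A + mult x B
mult-++ x []      B = refl
mult-++ x (y ∷ A) B = begin
  mult x (y ∷ A ++ B)           ≡⟨ mult-∷ x y (A ++ B) ⟩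
  δ y x + mult x (A ++ B)       ≡⟨ cong (δ y x +_) (mult-++ x A B) ⟩
  δ y x + (mult x A + mult x B) ≡⟨ +-assoc (δ y x) _ _ ⟨
  δ y x + mult x A + mult x B   ≡⟨ cong (_+ mult x B) (mult-∷ x y A) ⟨
  mult x (y ∷ A) + mult x B     ∎
  where open ≡-Reasoning

mult-replicate : ∀ x r y → mult x (replicate r y) ≡ r * δ y x
mult-replicate x zero    y = refl
mult-replicate x (suc r) y = trans (mult-∷ x y _) (cong (δ y x +_) (mult-replicate x r y))

mult≡0 : ∀ {x L} → All (_≢ x) L → mult x L ≡ 0
mult≡0 []                      = refl
mult≡0 {L = _ ∷ L} (y≢x ∷ ≢xs) = trans (mult-∷-≢ L y≢x) (mult≡0 ≢xs)

mult≡0⇒All≢ : ∀ x L → mult x L ≡ 0 → All (_≢ x) L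
mult≡0⇒All≢ x []      _ = []
mult≡0⇒All≢ x (y ∷ L) m≡0 with y ≟ x
... | no  y≢x = y≢x ∷ mult≡0⇒All≢ x L m≡0

lookup-mult : ∀ {P : ℕ → Set} {x L} → All P L → 1 ≤ mult x L → P x
lookup-mult {x = x} {y ∷ L} (py ∷ ps) 1≤m with y ≟ x
... | yes refl = py
... | no  _    = lookup-mult ps 1≤m

mult-↭ : ∀ x {L M} → L ↭ M → mult x L ≡ mult x M
mult-↭ x ↭.refl                  = refl
mult-↭ x (↭.prep y L↭M)          = trans (mult-∷ x y _) (trans (cong (δ y x +_) (mult-↭ x L↭M)) (sym (mult-∷ x y _)))
mult-↭ x (↭.swap {L} {M} y z L↭M) = begin
  mult x (y ∷ z ∷ L)        ≡⟨ trans (mult-∷ x y _) (cong (δ y x +_) (mult-∷ x z L)) ⟩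
  δ y x + (δ z x + mult x L) ≡⟨ cong (λ m → δ y x + (δ z x + m)) (mult-↭ x L↭M) ⟩
  δ y x + (δ z x + mult x M) ≡⟨ exchange (δ y x) (δ z x) (mult x M) ⟩
  δ z x + (δ y x + mult x M) ≡⟨ trans (mult-∷ x z _) (cong (δ z x +_) (mult-∷ x y M)) ⟨
  mult x (z ∷ y ∷ M)        ∎
  where
  open ≡-Reasoning
  exchange : ∀ a b c → a + (b + c) ≡ b + (a + c)
  exchange = solve-∀
mult-↭ x (↭.trans L↭K K↭M)       = trans (mult-↭ x L↭K) (mult-↭ x K↭M)

sum-map-++ : ∀ (h : ℕ → ℕ) A B → sum (map h (A ++ B)) ≡ sum (map h A) + sum (map h B)
sum-map-++ h A B = trans (cong sum (map-++ h A B)) (sum-++ (map h A) (map h B))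

sum-map-replicate : ∀ (h : ℕ → ℕ) r y → sum (map h (replicate r y)) ≡ r * h y
sum-map-replicate h zero    y = refl
sum-map-replicate h (suc r) y = cong (h y +_) (sum-map-replicate h r y)

sum-map-↭ : ∀ (h : ℕ → ℕ) {L M} → L ↭ M → sum (map h L) ≡ sum (map h M)
sum-map-↭ h L↭M = sum-↭ (↭.map⁺ h L↭M)

remove : ℕ → List ℕ → List ℕ
remove p []      = []
remove p (y ∷ L) with y ≟ p
... | yes _ = L
... | no  _ = y ∷ remove p L

remove-↭ : ∀ p L → 1 ≤ mult p L → p ∷ remove p L ↭ L
remove-↭ p (y ∷ L) 1≤m with y ≟ p
... | yes refl = ↭.refl
... | no  _    = ↭.trans (↭.swap p y ↭.refl) (↭.prep y (remove-↭ p L 1≤m))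

remove-All : ∀ {P : ℕ → Set} p {L} → All P L → All P (remove p L)
remove-All p {y ∷ L} (py ∷ ps) with y ≟ p
... | yes _ = ps
... | no  _ = py ∷ remove-All p ps
remove-All p [] = []

remove-AllPairs : ∀ {R : ℕ → ℕ → Set} p {L} → AllPairs R L → AllPairs R (remove p L)
remove-AllPairs p [] = []
remove-AllPairs p {y ∷ L} (Ry ∷ Rs) with y ≟ p
... | yes _ = Rs
... | no  _ = remove-All p Ry ∷ remove-AllPairs p Rs

mult≤mult-∷ : ∀ x y L → mult x L ≤ mult x (y ∷ L)
mult≤mult-∷ x y L = subst (mult x L ≤_) (sym (mult-∷ x y L)) (m≤n+m (mult x L) (δ y x))

mult-above : ∀ {x y L} → All (_≤ x) L → x < y → mult y L ≡ 0
mult-above ≤x x<y = mult≡0 (All.map (λ z≤x → <⇒≢ (≤-<-trans z≤x x<y)) ≤x)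

decreasing-unique : ∀ {L M} → AllPairs _≥_ L → AllPairs _≥_ M → (∀ x → mult x L ≡ mult x M) → L ≡ M
decreasing-unique {[]}    {[]}    _ _ _ = refl
decreasing-unique {[]}    {y ∷ M} _ _ same = contradiction (trans (same y) (mult-∷-self y M)) 0≢1+n
decreasing-unique {x ∷ L} {[]}    _ _ same = contradiction (trans (sym (same x)) (mult-∷-self x L)) 0≢1+n
decreasing-unique {x ∷ L} {y ∷ M} (≤x ∷ L↓) (≤y ∷ M↓) same with <-cmp x y
... | tri≈ _ refl _ = cong (x ∷_) (decreasing-unique L↓ M↓ λ z →
        +-cancelˡ-≡ (δ x z) _ _ (trans (sym (mult-∷ z x L)) (trans (same z) (mult-∷ z x M))))
... | tri< x<y _ _ = contradiction
        (trans (sym (mult-above (≤-refl ∷ ≤x) x<y)) (trans (same y) (mult-∷-self y M))) 0≢1+n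
... | tri> _ _ y<x = contradiction
        (trans (sym (mult-above (≤-refl ∷ ≤y) y<x)) (trans (sym (same x)) (mult-∷-self x L))) 0≢1+n

strictly-decreasing : ∀ {L} → AllPairs _≥_ L → (∀ x → mult x L ≤ 1) → AllPairs _>_ L
strictly-decreasing []                  _  = []
strictly-decreasing {x ∷ L} (≤x ∷ L↓) ≤1 =
  All.zipWith (λ (y≤x , y≢x) → ≤∧≢⇒< y≤x y≢x) (≤x , mult≡0⇒All≢ x L x∉L)
  ∷ strictly-decreasing L↓ (λ z → ≤-trans (mult≤mult-∷ z x L) (≤1 z))
  where
  x∉L : mult x L ≡ 0
  x∉L = n≤0⇒n≡0 (≤-pred (subst (_≤ 1) (mult-∷-self x L) (≤1 x)))

Linked⇒decreasing : ∀ {L} → Linked _≥_ L → AllPairs _≥_ L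
Linked⇒decreasing = Linked⇒AllPairs (λ x≥y y≥z → ≤-trans y≥z x≥y)

All-≤-sum : ∀ L → All (_≤ sum L) L
All-≤-sum []      = []
All-≤-sum (x ∷ L) = m≤m+n x (sum L) ∷ All.map (λ y≤ → ≤-trans y≤ (m≤n+m (sum L) x)) (All-≤-sum L)

mult⇒All : ∀ {P : ℕ → Set} L → (∀ x → 1 ≤ mult x L → P x) → All P L
mult⇒All []      _      = []
mult⇒All (y ∷ L) P-mult = P-mult y (subst (1 ≤_) (sym (mult-∷-self y L)) (s≤s z≤n))
  ∷ mult⇒All L (λ x 1≤mult → P-mult x (≤-trans 1≤mult (mult≤mult-∷ x y L)))

partition-parts>0 : ∀ {n L} → IsPartition n L → All (1 ≤_) L
partition-parts>0 = proj₁ ∘ proj₂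

partition-parts≤ : ∀ {n L} → IsPartition n L → All (_≤ n) L
partition-parts≤ {L = L} (_ , _ , sum≡n) = subst (λ s → All (_≤ s) L) sum≡n (All-≤-sum L)

partition-≡ : ∀ {n L M} → IsPartition n L → IsPartition n M → (∀ x → 1 ≤ x → mult x L ≡ mult x M) → L ≡ M
partition-≡ {L = L} {M} (L↓ , L>0 , _) (M↓ , M>0 , _) same =
  decreasing-unique (Linked⇒decreasing L↓) (Linked⇒decreasing M↓) same′
  where
  mult-0 : ∀ {K} → All (0 <_) K → mult 0 K ≡ 0
  mult-0 K>0 = mult≡0 (All.map (λ 0<y → <⇒≢ 0<y ∘ sym) K>0)
  same′ : ∀ x → mult x L ≡ mult x M
  same′ zero    = trans (mult-0 L>0) (sym (mult-0 M>0))
  same′ (suc x) = same (suc x) (s≤s z≤n)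

sumTo : ℕ → (ℕ → ℕ) → ℕ
sumTo zero    F = 0
sumTo (suc t) F = F (suc t) + sumTo t F

sumTo-cong : ∀ t {F G} → (∀ x → F x ≡ G x) → sumTo t F ≡ sumTo t G
sumTo-cong zero    F≡G = refl
sumTo-cong (suc t) F≡G = cong₂ _+_ (F≡G (suc t)) (sumTo-cong t F≡G)

sumTo-+ : ∀ t F G → sumTo t (λ x → F x + G x) ≡ sumTo t F + sumTo t G
sumTo-+ zero    F G = refl
sumTo-+ (suc t) F G = trans (cong (F (suc t) + G (suc t) +_) (sumTo-+ t F G))
  (interchange (F (suc t)) (G (suc t)) (sumTo t F) (sumTo t G))
  where
  interchange : ∀ a b c d → a + b + (c + d) ≡ a + c + (b + d)
  interchange = solve-∀

sumTo-0 : ∀ t F → (∀ x → F x ≡ 0) → sumTo t F ≡ 0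
sumTo-0 zero    F F≡0 = refl
sumTo-0 (suc t) F F≡0 = cong₂ _+_ (F≡0 (suc t)) (sumTo-0 t F F≡0)

sumTo-outside : ∀ t {y} F → (∀ x → x ≢ y → F x ≡ 0) → t < y → sumTo t F ≡ 0
sumTo-outside zero    F F≡0 t<y = refl
sumTo-outside (suc t) F F≡0 t<y =
  cong₂ _+_ (F≡0 (suc t) (<⇒≢ t<y)) (sumTo-outside t F F≡0 (<-trans (n<1+n t) t<y))

sumTo-single : ∀ t {y} F → (∀ x → x ≢ y → F x ≡ 0) → 1 ≤ y → y ≤ t → sumTo t F ≡ F y
sumTo-single zero    F F≡0 1≤y y≤0 = contradiction (≤-trans 1≤y y≤0) λ ()
sumTo-single (suc t) {y} F F≡0 1≤y y≤t with suc t ≟ y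
... | yes refl = trans (cong (F (suc t) +_) (sumTo-outside t F F≡0 (n<1+n t))) (+-identityʳ _)
... | no  t≢y  = trans (cong (_+ sumTo t F) (F≡0 (suc t) t≢y))
                       (sumTo-single t F F≡0 1≤y (≤-pred (≤∧≢⇒< y≤t (t≢y ∘ sym))))

blocks : (ℕ → List ℕ) → ℕ → List ℕ
blocks g zero    = []
blocks g (suc t) = g (suc t) ++ blocks g t

sum-map-blocks : ∀ (h : ℕ → ℕ) g t → sum (map h (blocks g t)) ≡ sumTo t (λ o → sum (map h (g o)))
sum-map-blocks h g zero    = refl
sum-map-blocks h g (suc t) =
  trans (sum-map-++ h (g (suc t)) (blocks g t)) (cong (sum (map h (g (suc t))) +_) (sum-map-blocks h g t))

sum-blocks : ∀ g t → sum (blocks g t) ≡ sumTo t (λ o → sum (g o))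
sum-blocks g zero    = refl
sum-blocks g (suc t) = trans (sum-++ (g (suc t)) (blocks g t)) (cong (sum (g (suc t)) +_) (sum-blocks g t))

All-blocks : ∀ {P : ℕ → Set} g t → (∀ o → 1 ≤ o → o ≤ t → All P (g o)) → All P (blocks g t)
All-blocks g zero    P-g = []
All-blocks g (suc t) P-g =
  All-++⁺ (P-g (suc t) (s≤s z≤n) ≤-refl) (All-blocks g t λ o 1≤o o≤t → P-g o 1≤o (m≤n⇒m≤1+n o≤t))

mult-blocks : ∀ (κ : ℕ → ℕ) g t {x} → (∀ o → All (λ y → κ y ≡ o) (g o)) → 1 ≤ κ x → κ x ≤ t →
  mult x (blocks g t) ≡ mult x (g (κ x))
mult-blocks κ g zero    κ-g 1≤κx κx≤0 = contradiction (≤-trans 1≤κx κx≤0) λ ()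
mult-blocks κ g (suc t) {x} κ-g 1≤κx κx≤t with suc t ≟ κ x
... | yes t≡κx = begin
  mult x (g (suc t) ++ blocks g t)          ≡⟨ mult-++ x (g (suc t)) (blocks g t) ⟩
  mult x (g (suc t)) + mult x (blocks g t)  ≡⟨ cong₂ _+_ (cong (λ o → mult x (g o)) t≡κx) (mult≡0 below-κx) ⟩
  mult x (g (κ x)) + 0                      ≡⟨ +-identityʳ _ ⟩
  mult x (g (κ x))                          ∎
  where
  open ≡-Reasoning
  below-κx : All (_≢ x) (blocks g t)
  below-κx = All-blocks g t λ o _ o≤t →
    All.map (λ κy≡o y≡x → <⇒≢ (s≤s o≤t) (trans (sym κy≡o) (trans (cong κ y≡x) (sym t≡κx)))) (κ-g o)
... | no  t≢κx = begin
  mult x (g (suc t) ++ blocks g t)          ≡⟨ mult-++ x (g (suc t)) (blocks g t) ⟩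
  mult x (g (suc t)) + mult x (blocks g t)  ≡⟨ cong₂ _+_ (mult≡0 other-class) (mult-blocks κ g t κ-g 1≤κx κx≤t′) ⟩
  mult x (g (κ x))                          ∎
  where
  open ≡-Reasoning
  other-class : All (_≢ x) (g (suc t))
  other-class = All.map (λ κy≡t y≡x → t≢κx (trans (sym κy≡t) (cong κ y≡x))) (κ-g (suc t))
  κx≤t′ : κ x ≤ t
  κx≤t′ = ≤-pred (≤∧≢⇒< κx≤t (t≢κx ∘ sym))

partUnits : ℕ → ℕ → ℕ
partUnits o x = δ (oddPart x) o * 2 ^ ν₂ x

units : ℕ → List ℕ → ℕ
units o L = sum (map (partUnits o) L)

InClass : ℕ → ℕ → Set
InClass o x = 1 ≤ x × oddPart x ≡ o

ν₂-of-odd : ∀ z → Odd z → ν₂ z ≡ 0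
ν₂-of-odd z odd = subst (λ x → ν₂ x ≡ 0) (*-identityʳ z) (ν₂-*2^ z 0 odd)

partUnits-*2^ : ∀ o i → Odd o → partUnits o (o * 2 ^ i) ≡ 2 ^ i
partUnits-*2^ o i odd = begin
  δ (oddPart (o * 2 ^ i)) o * 2 ^ ν₂ (o * 2 ^ i) ≡⟨ cong₂ (λ a b → δ a o * 2 ^ b) (oddPart-*2^ o i odd) (ν₂-*2^ o i odd) ⟩
  δ o o * 2 ^ i                                 ≡⟨ cong (_* 2 ^ i) (δ-refl o) ⟩
  1 * 2 ^ i                                     ≡⟨ *-identityˡ (2 ^ i) ⟩
  2 ^ i                                         ∎
  where open ≡-Reasoning

partUnits-odd : ∀ o z → Odd z → partUnits o z ≡ δ z o
partUnits-odd o z odd = begin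
  δ (oddPart z) o * 2 ^ ν₂ z ≡⟨ cong₂ (λ a b → δ a o * 2 ^ b) (oddPart-of-odd z odd) (ν₂-of-odd z odd) ⟩
  δ z o * 1                  ≡⟨ *-identityʳ (δ z o) ⟩
  δ z o                      ∎
  where open ≡-Reasoning

partUnits-other : ∀ {o} x → oddPart x ≢ o → partUnits o x ≡ 0
partUnits-other x ≢o = cong (_* 2 ^ ν₂ x) (δ-≢ ≢o)

oddPart*partUnits : ∀ {x} → 1 ≤ x → oddPart x * partUnits (oddPart x) x ≡ x
oddPart*partUnits {x} 1≤x = begin
  oddPart x * (δ (oddPart x) (oddPart x) * 2 ^ ν₂ x) ≡⟨ cong (λ d → oddPart x * (d * 2 ^ ν₂ x)) (δ-refl (oddPart x)) ⟩
  oddPart x * (1 * 2 ^ ν₂ x)                         ≡⟨ cong (oddPart x *_) (*-identityˡ (2 ^ ν₂ x)) ⟩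
  oddPart x * 2 ^ ν₂ x                               ≡⟨ oddPart*2^ν₂ 1≤x ⟩
  x                                                  ∎
  where open ≡-Reasoning

units≡0 : ∀ {o L} → All (λ y → oddPart y ≢ o) L → units o L ≡ 0
units≡0 []          = refl
units≡0 {L = y ∷ _} (≢o ∷ ≢os) = cong₂ _+_ (partUnits-other y ≢o) (units≡0 ≢os)

units-¬Odd : ∀ {o L} → ¬ Odd o → All (1 ≤_) L → units o L ≡ 0
units-¬Odd ¬odd L>0 = units≡0 (All.map (λ 1≤y oddPart≡o → ¬odd (subst Odd oddPart≡o (oddPart-odd 1≤y))) L>0)

sum≡o*units : ∀ {o L} → All (InClass o) L → sum L ≡ o * units o L
sum≡o*units {o} []                             = sym (*-zeroʳ o)
sum≡o*units {L = y ∷ L} ((1≤y , refl) ∷ L-class) = begin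
  y + sum L
    ≡⟨ cong₂ _+_ (oddPart*partUnits 1≤y) (sym (sum≡o*units L-class)) ⟨
  oddPart y * partUnits (oddPart y) y + oddPart y * units (oddPart y) L
    ≡⟨ *-distribˡ-+ (oddPart y) _ _ ⟨
  oddPart y * units (oddPart y) (y ∷ L)
    ∎
  where open ≡-Reasoning

sum≡sumTo-units : ∀ t L → All (λ y → 1 ≤ y × oddPart y ≤ t) L → sum L ≡ sumTo t (λ o → o * units o L)
sum≡sumTo-units t []      []                  = sym (sumTo-0 t _ *-zeroʳ)
sum≡sumTo-units t (y ∷ L) ((1≤y , y≤t) ∷ ys) = begin
  y + sum L                                                          ≡⟨ cong₂ _+_ (sym y-by-classes) (sum≡sumTo-units t L ys) ⟩
  sumTo t (λ o → o * partUnits o y) + sumTo t (λ o → o * units o L)  ≡⟨ sumTo-+ t _ _ ⟨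
  sumTo t (λ o → o * partUnits o y + o * units o L)                  ≡⟨ sumTo-cong t (λ o → *-distribˡ-+ o _ _) ⟨
  sumTo t (λ o → o * units o (y ∷ L))                                ∎
  where
  open ≡-Reasoning
  y-by-classes : sumTo t (λ o → o * partUnits o y) ≡ y
  y-by-classes = trans
    (sumTo-single t (λ o → o * partUnits o y) (λ o o≢ → trans (cong (o *_) (partUnits-other y (o≢ ∘ sym))) (*-zeroʳ o))
      (Odd⇒1≤ (oddPart-odd 1≤y)) y≤t)
    (oddPart*partUnits 1≤y)

module Regroup {n L} (L-partition : IsPartition n L) (g : ℕ → List ℕ)
  (g-class : ∀ o → All (InClass o) (g o))
  (g-units : ∀ o → Odd o → units o (g o) ≡ units o L) where

  R : List ℕ
  R = sort (blocks g n)

  private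
    R↭blocks : R ↭ blocks g n
    R↭blocks = sort-↭ (blocks g n)

    L>0 : All (1 ≤_) L
    L>0 = partition-parts>0 L-partition

    L-oddParts≤n : All (λ y → oddPart y ≤ n) L
    L-oddParts≤n = All.zipWith (λ (1≤y , y≤n) → ≤-trans (oddPart≤ 1≤y) y≤n) (L>0 , partition-parts≤ L-partition)

    units-g : ∀ o → units o (g o) ≡ units o L
    units-g o with Odd? o
    ... | yes odd = g-units o odd
    ... | no ¬odd = trans (units-¬Odd ¬odd (All.map proj₁ (g-class o))) (sym (units-¬Odd ¬odd L>0))

    units-other-class : ∀ {o o′} → o′ ≢ o → units o (g o′) ≡ 0
    units-other-class o′≢o = units≡0 (All.map (λ (_ , ≡o′) ≡o → o′≢o (trans (sym ≡o′) ≡o)) (g-class _))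

  units-R : ∀ o → Odd o → units o R ≡ units o L
  units-R o odd = begin
    units o R                        ≡⟨ sum-map-↭ (partUnits o) R↭blocks ⟩
    units o (blocks g n)             ≡⟨ sum-map-blocks (partUnits o) g n ⟩
    sumTo n (λ o′ → units o (g o′))  ≡⟨ by-range (o ≤? n) ⟩
    units o L                        ∎
    where
    open ≡-Reasoning
    by-range : Dec (o ≤ n) → sumTo n (λ o′ → units o (g o′)) ≡ units o L
    by-range (yes o≤n) = trans (sumTo-single n _ (λ _ → units-other-class) (Odd⇒1≤ odd) o≤n) (units-g o)
    by-range (no  o≰n) = trans (sumTo-outside n _ (λ _ → units-other-class) (≰⇒> o≰n))
      (sym (units≡0 (All.map (λ oddPart≤n ≡o → o≰n (subst (_≤ n) ≡o oddPart≤n)) L-oddParts≤n)))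

  All-R : ∀ {P : ℕ → Set} → (∀ o → All P (g o)) → All P R
  All-R P-g = ↭.All-resp-↭ (↭.↭-sym R↭blocks) (All-blocks g n (λ o _ _ → P-g o))

  R-partition : IsPartition n R
  R-partition = sort-↗ (blocks g n) , All-R (λ o → All.map proj₁ (g-class o)) , (begin
    sum R                                ≡⟨ sum-↭ R↭blocks ⟩
    sum (blocks g n)                     ≡⟨ sum-blocks g n ⟩
    sumTo n (λ o → sum (g o))            ≡⟨ sumTo-cong n (λ o → trans (sum≡o*units (g-class o)) (cong (o *_) (units-g o))) ⟩
    sumTo n (λ o → o * units o L)        ≡⟨ sum≡sumTo-units n L (All.zipWith id (L>0 , L-oddParts≤n)) ⟨
    sum L                                ≡⟨ proj₂ (proj₂ L-partition) ⟩
    n                                    ∎)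
    where open ≡-Reasoning

  mult-R : ∀ {x} → 1 ≤ x → oddPart x ≤ n → mult x R ≡ mult x (g (oddPart x))
  mult-R {x} 1≤x oddPart≤n = trans (mult-↭ x R↭blocks)
    (mult-blocks oddPart g n (λ o → All.map proj₂ (g-class o)) (Odd⇒1≤ (oddPart-odd 1≤x)) oddPart≤n)

binaryParts : ℕ → ℕ → ℕ → ℕ → List ℕ
binaryParts o s U zero       = []
binaryParts o s U (suc fuel) = replicate (U % 2) (o * 2 ^ s) ++ binaryParts o (suc s) (U / 2) fuel

binaryExpansion : ℕ → ℕ → List ℕ
binaryExpansion o U = binaryParts o 0 U U

private
  /2≤ : ∀ U fuel → U ≤ suc fuel → U / 2 ≤ fuel
  /2≤ zero    fuel _   = z≤n
  /2≤ (suc U) fuel U≤ = ≤-pred (≤-trans (m/n<m (suc U) 2 (s≤s (s≤s z≤n))) U≤)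

binaryParts-class : ∀ o s U fuel → Odd o → All (λ y → InClass o y × s ≤ ν₂ y) (binaryParts o s U fuel)
binaryParts-class o s U zero       odd = []
binaryParts-class o s U (suc fuel) odd = All-++⁺
  (All-replicate⁺ (U % 2) ((Odd-*2^⇒1≤ o s odd , oddPart-*2^ o s odd) , ≤-reflexive (sym (ν₂-*2^ o s odd))))
  (All.map (Product.map₂ (≤-trans (n≤1+n s))) (binaryParts-class o (suc s) (U / 2) fuel odd))

mult-binaryParts-suc : ∀ o s U fuel x →
  mult x (binaryParts o s U (suc fuel)) ≡ U % 2 * δ (o * 2 ^ s) x + mult x (binaryParts o (suc s) (U / 2) fuel)
mult-binaryParts-suc o s U fuel x = trans (mult-++ x (replicate (U % 2) (o * 2 ^ s)) _)
  (cong (_+ mult x (binaryParts o (suc s) (U / 2) fuel)) (mult-replicate x (U % 2) (o * 2 ^ s)))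

mult-binaryParts : ∀ o s U fuel t → Odd o → U ≤ fuel → mult (o * 2 ^ (s + t)) (binaryParts o s U fuel) ≡ bit t U
mult-binaryParts o s zero zero t odd _ = sym (bit-0 t)
mult-binaryParts o s U (suc fuel) zero odd U≤ = begin
  mult (o * 2 ^ (s + 0)) parts                           ≡⟨ cong (λ i → mult (o * 2 ^ i) parts) (+-identityʳ s) ⟩
  mult x parts                                           ≡⟨ mult-binaryParts-suc o s U fuel x ⟩
  U % 2 * δ x x + mult x rest                            ≡⟨ cong₂ (λ d m → U % 2 * d + m) (δ-refl x) (mult≡0 higher) ⟩
  U % 2 * 1 + 0                                          ≡⟨ trans (+-identityʳ _) (*-identityʳ _) ⟩
  U % 2                                                  ∎
  where
  open ≡-Reasoning
  x = o * 2 ^ s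
  parts = binaryParts o s U (suc fuel)
  rest = binaryParts o (suc s) (U / 2) fuel
  higher : All (_≢ x) rest
  higher = All.map (λ (_ , s<ν₂y) y≡x → <⇒≢ s<ν₂y (sym (trans (cong ν₂ y≡x) (ν₂-*2^ o s odd))))
    (binaryParts-class o (suc s) (U / 2) fuel odd)
mult-binaryParts o s U (suc fuel) (suc t) odd U≤ = begin
  mult x (binaryParts o s U (suc fuel))                  ≡⟨ mult-binaryParts-suc o s U fuel x ⟩
  U % 2 * δ (o * 2 ^ s) x + mult x rest                  ≡⟨ cong (λ d → U % 2 * d + mult x rest) (δ-≢ lower) ⟩
  U % 2 * 0 + mult x rest                                ≡⟨ cong (_+ mult x rest) (*-zeroʳ (U % 2)) ⟩
  mult x rest                                            ≡⟨ cong (λ i → mult (o * 2 ^ i) rest) (+-suc s t) ⟩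
  mult (o * 2 ^ (suc s + t)) rest                        ≡⟨ mult-binaryParts o (suc s) (U / 2) fuel t odd (/2≤ U fuel U≤) ⟩
  bit t (U / 2)                                          ∎
  where
  open ≡-Reasoning
  x = o * 2 ^ (s + suc t)
  rest = binaryParts o (suc s) (U / 2) fuel
  lower : o * 2 ^ s ≢ x
  lower eq = <⇒≢ (m<m+n s (s≤s z≤n)) (proj₂ (*2^-injective {o} {o} s (s + suc t) odd odd eq))

units-binaryParts : ∀ o s U fuel → Odd o → U ≤ fuel → units o (binaryParts o s U fuel) ≡ 2 ^ s * U
units-binaryParts o s zero zero       odd _  = sym (*-zeroʳ (2 ^ s))
units-binaryParts o s U    (suc fuel) odd U≤ = begin
  units o (replicate (U % 2) (o * 2 ^ s) ++ rest)              ≡⟨ sum-map-++ (partUnits o) (replicate (U % 2) (o * 2 ^ s)) rest ⟩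
  units o (replicate (U % 2) (o * 2 ^ s)) + units o rest       ≡⟨ cong₂ _+_ (sum-map-replicate (partUnits o) (U % 2) (o * 2 ^ s))
                                                                     (units-binaryParts o (suc s) (U / 2) fuel odd (/2≤ U fuel U≤)) ⟩
  U % 2 * partUnits o (o * 2 ^ s) + 2 ^ suc s * (U / 2)        ≡⟨ cong (λ u → U % 2 * u + 2 ^ suc s * (U / 2)) (partUnits-*2^ o s odd) ⟩
  U % 2 * 2 ^ s + 2 * 2 ^ s * (U / 2)                          ≡⟨ factor (U % 2) (2 ^ s) (U / 2) ⟩
  2 ^ s * (U % 2 + U / 2 * 2)                                  ≡⟨ cong (2 ^ s *_) (m≡m%n+[m/n]*n U 2) ⟨
  2 ^ s * U                                                    ∎
  where
  open ≡-Reasoning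
  rest = binaryParts o (suc s) (U / 2) fuel
  factor : ∀ a b c → a * b + 2 * b * c ≡ b * (a + c * 2)
  factor = solve-∀

binaryExpansion-class : ∀ o U → Odd o → All (InClass o) (binaryExpansion o U)
binaryExpansion-class o U odd = All.map proj₁ (binaryParts-class o 0 U U odd)

mult-binaryExpansion : ∀ o U t → Odd o → mult (o * 2 ^ t) (binaryExpansion o U) ≡ bit t U
mult-binaryExpansion o U t odd = mult-binaryParts o 0 U U t odd ≤-refl

units-binaryExpansion : ∀ o U → Odd o → units o (binaryExpansion o U) ≡ U
units-binaryExpansion o U odd = trans (units-binaryParts o 0 U U odd ≤-refl) (*-identityˡ U)

partUnits-in-class : ∀ {o} y → oddPart y ≡ o → partUnits o y ≡ 2 ^ ν₂ y
partUnits-in-class y refl = trans (cong (_* 2 ^ ν₂ y) (δ-refl (oddPart y))) (*-identityˡ (2 ^ ν₂ y))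

class-form : ∀ {o y} → 1 ≤ y → oddPart y ≡ o → y ≡ o * 2 ^ ν₂ y
class-form 1≤y refl = sym (oddPart*2^ν₂ 1≤y)

δ-*2^ : ∀ o d i → Odd o → δ (o * 2 ^ d) (o * 2 ^ i) ≡ δ d i
δ-*2^ o d i odd with d ≟ i
... | yes refl = δ-refl (o * 2 ^ d)
... | no  d≢i  = δ-≢ (d≢i ∘ proj₂ ∘ *2^-injective {o} {o} d i odd odd)

units-<-2^ : ∀ {L} d → AllPairs _>_ L → All (1 ≤_) L → ∀ {o} → Odd o → All (_< o * 2 ^ d) L → units o L < 2 ^ d
units-<-2^ d [] [] _ _ = 2^>0 d
units-<-2^ {y ∷ L} d (>y ∷ L↓) (1≤y ∷ L>0) {o} odd (y< ∷ L<) = by-class (oddPart y ≟ o)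
  where
  open ≤-Reasoning
  by-class : Dec (oddPart y ≡ o) → partUnits o y + units o L < 2 ^ d
  by-class (no ≢o) = begin-strict
    partUnits o y + units o L  ≡⟨ cong (_+ units o L) (partUnits-other y ≢o) ⟩
    units o L                  <⟨ units-<-2^ d L↓ L>0 odd L< ⟩
    2 ^ d                      ∎
  by-class (yes y∈o) = begin-strict
    partUnits o y + units o L  ≡⟨ cong (_+ units o L) (partUnits-in-class y y∈o) ⟩
    2 ^ e + units o L          <⟨ +-monoʳ-< (2 ^ e) (units-<-2^ e L↓ L>0 odd L<y) ⟩
    2 ^ e + 2 ^ e              ≡⟨ 2^suc≡2^+2^ e ⟨
    2 ^ suc e                  ≤⟨ 2^-mono-≤ e<d ⟩
    2 ^ d                      ∎
    where
    e = ν₂ y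
    L<y : All (_< o * 2 ^ e) L
    L<y = All.map (λ z<y → subst (_ <_) (class-form 1≤y y∈o) z<y) >y
    e<d : e < d
    e<d = 2^-cancel-< (*-cancelˡ-< o (2 ^ e) (2 ^ d) (subst (_< o * 2 ^ d) (class-form 1≤y y∈o) y<))

bit-units : ∀ {L} → AllPairs _>_ L → All (1 ≤_) L → ∀ {o} → Odd o → ∀ i → bit i (units o L) ≡ mult (o * 2 ^ i) L
bit-units [] [] _ i = bit-0 i
bit-units {y ∷ L} (>y ∷ L↓) (1≤y ∷ L>0) {o} odd i = by-class (oddPart y ≟ o)
  where
  open ≡-Reasoning
  x = o * 2 ^ i
  r = units o L
  by-class : Dec (oddPart y ≡ o) → bit i (partUnits o y + r) ≡ mult x (y ∷ L)
  by-class (no ≢o) = begin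
    bit i (partUnits o y + r)  ≡⟨ cong (λ u → bit i (u + r)) (partUnits-other y ≢o) ⟩
    bit i r                    ≡⟨ bit-units L↓ L>0 odd i ⟩
    mult x L                   ≡⟨ mult-∷-≢ L (≢o ∘ y≡x⇒oddPart) ⟨
    mult x (y ∷ L)             ∎
    where
    y≡x⇒oddPart : y ≡ x → oddPart y ≡ o
    y≡x⇒oddPart y≡x = trans (cong oddPart y≡x) (oddPart-*2^ o i odd)
  by-class (yes y∈o) = begin
    bit i (partUnits o y + r)  ≡⟨ cong (λ u → bit i (u + r)) (partUnits-in-class y y∈o) ⟩
    bit i (2 ^ e + r)          ≡⟨ cong (bit i) (+-comm (2 ^ e) r) ⟩
    bit i (r + 2 ^ e)          ≡⟨ bit-[r+2^d] i e r<2^e ⟩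
    δ e i + bit i r            ≡⟨ cong₂ _+_ δ-eq (bit-units L↓ L>0 odd i) ⟩
    δ y x + mult x L           ≡⟨ mult-∷ x y L ⟨
    mult x (y ∷ L)             ∎
    where
    e = ν₂ y
    y≡o*2^e : y ≡ o * 2 ^ e
    y≡o*2^e = class-form 1≤y y∈o
    r<2^e : r < 2 ^ e
    r<2^e = units-<-2^ e L↓ L>0 odd (All.map (λ z<y → subst (_ <_) y≡o*2^e z<y) >y)
    δ-eq : δ e i ≡ δ y x
    δ-eq = trans (sym (δ-*2^ o e i odd)) (cong (λ z → δ z x) (sym y≡o*2^e))

module A₁Structure {L k m} (k≥1 : 1 ≤ k) (m-odd : Odd m) (parts : All (λ q → Odd q ⊎ q ≡ 2 ^ k * m) L) where

  e : ℕ
  e = 2 ^ k * m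

  e≡m*2^k : e ≡ m * 2 ^ k
  e≡m*2^k = *-comm (2 ^ k) m

  e-even : ¬ Odd e
  e-even = ¬Odd-2^* m k≥1

  oddPart-e : oddPart e ≡ m
  oddPart-e = trans (cong oddPart e≡m*2^k) (oddPart-*2^ m k m-odd)

  ν₂-e : ν₂ e ≡ k
  ν₂-e = trans (cong ν₂ e≡m*2^k) (ν₂-*2^ m k m-odd)

  partUnits-part : ∀ {o} → Odd o → ∀ {y} → Odd y ⊎ y ≡ e → partUnits o y ≡ δ y o + δ y e * partUnits o e
  partUnits-part {o} o-odd {y} (inj₁ y-odd) = begin
    partUnits o y                  ≡⟨ partUnits-odd o y y-odd ⟩
    δ y o                          ≡⟨ +-identityʳ (δ y o) ⟨
    δ y o + 0 * partUnits o e      ≡⟨ cong (λ d → δ y o + d * partUnits o e) (δ-≢ y≢e) ⟨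
    δ y o + δ y e * partUnits o e  ∎
    where
    open ≡-Reasoning
    y≢e : y ≢ e
    y≢e y≡e = e-even (subst Odd y≡e y-odd)
  partUnits-part {o} o-odd (inj₂ refl) = begin
    partUnits o e                  ≡⟨ *-identityˡ (partUnits o e) ⟨
    1 * partUnits o e              ≡⟨ cong₂ (λ d d′ → d + d′ * partUnits o e) (δ-≢ e≢o) (δ-refl e) ⟨
    δ e o + δ e e * partUnits o e  ∎
    where
    open ≡-Reasoning
    e≢o : e ≢ o
    e≢o e≡o = e-even (subst Odd (sym e≡o) o-odd)

  units-odd : ∀ {o} → Odd o → units o L ≡ mult o L + mult e L * partUnits o e
  units-odd {o} o-odd = go parts
    where
    open ≡-Reasoning
    u = partUnits o e
    go : ∀ {K} → All (λ q → Odd q ⊎ q ≡ e) K → units o K ≡ mult o K + mult e K * u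
    go []                    = refl
    go {y ∷ K} (y-part ∷ ps) = begin
      partUnits o y + units o K                         ≡⟨ cong₂ _+_ (partUnits-part o-odd y-part) (go ps) ⟩
      δ y o + δ y e * u + (mult o K + mult e K * u)     ≡⟨ regroup (δ y o) (δ y e) (mult o K) (mult e K) u ⟩
      (δ y o + mult o K) + (δ y e + mult e K) * u       ≡⟨ cong₂ (λ a b → a + b * u) (mult-∷ o y K) (mult-∷ e y K) ⟨
      mult o (y ∷ K) + mult e (y ∷ K) * u               ∎
      where
      regroup : ∀ a b c d u → a + b * u + (c + d * u) ≡ (a + c) + (b + d) * u
      regroup = solve-∀

  units-m : units m L ≡ mult m L + 2 ^ k * mult e L
  units-m = begin
    units m L                          ≡⟨ units-odd m-odd ⟩
    mult m L + mult e L * partUnits m e ≡⟨ cong (λ u → mult m L + mult e L * u) (partUnits-in-class e oddPart-e) ⟩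
    mult m L + mult e L * 2 ^ ν₂ e     ≡⟨ cong (λ i → mult m L + mult e L * 2 ^ i) ν₂-e ⟩
    mult m L + mult e L * 2 ^ k        ≡⟨ cong (mult m L +_) (*-comm (mult e L) (2 ^ k)) ⟩
    mult m L + 2 ^ k * mult e L        ∎
    where open ≡-Reasoning

  units-≢m : ∀ {o} → Odd o → o ≢ m → units o L ≡ mult o L
  units-≢m {o} o-odd o≢m = begin
    units o L                          ≡⟨ units-odd o-odd ⟩
    mult o L + mult e L * partUnits o e ≡⟨ cong (λ u → mult o L + mult e L * u) (partUnits-other e e∉o) ⟩
    mult o L + mult e L * 0            ≡⟨ cong (mult o L +_) (*-zeroʳ (mult e L)) ⟩
    mult o L + 0                       ≡⟨ +-identityʳ (mult o L) ⟩
    mult o L                           ∎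
    where
    open ≡-Reasoning
    e∉o : oddPart e ≢ o
    e∉o e∈o = o≢m (trans (sym e∈o) oddPart-e)

  mult-¬Odd : ∀ {x} → ¬ Odd x → x ≢ e → mult x L ≡ 0
  mult-¬Odd ¬odd x≢e = mult≡0 (All.map not-x parts)
    where
    not-x : ∀ {q} → Odd q ⊎ q ≡ e → q ≢ _
    not-x (inj₁ q-odd) refl = ¬odd q-odd
    not-x (inj₂ refl)  refl = x≢e refl

A₁-parameters : ∀ {L} → A₁ L → ℕ × ℕ
A₁-parameters (k , m , _) = k , m

A₁-determined : ∀ {L M} (a : A₁ L) (b : A₁ M) → A₁-parameters a ≡ A₁-parameters b →
  (∀ o → Odd o → units o L ≡ units o M) → ∀ x → mult x L ≡ mult x M
A₁-determined {L} {M} (k , m , k≥1 , m-odd , partsL , _ , _ , cL≤) (_ , _ , _ , _ , partsM , _ , _ , cM≤) refl same = by-cases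
  where
  module SL = A₁Structure {L} k≥1 m-odd partsL
  module SM = A₁Structure {M} k≥1 m-odd partsM
  digits : mult m L ≡ mult m M × mult SL.e L ≡ mult SL.e M
  digits = divMod-unique (≤∸1⇒< (2^>0 k) cL≤) (≤∸1⇒< (2^>0 k) cM≤)
    (trans (sym SL.units-m) (trans (same m m-odd) SM.units-m))
  by-cases : ∀ x → mult x L ≡ mult x M
  by-cases x with x ≟ m | x ≟ SL.e | Odd? x
  ... | yes refl | _        | _         = proj₁ digits
  ... | no _     | yes refl | _         = proj₂ digits
  ... | no x≢m   | no _     | yes x-odd = trans (sym (SL.units-≢m x-odd x≢m)) (trans (same x x-odd) (SM.units-≢m x-odd x≢m))
  ... | no _     | no x≢e   | no ¬odd   = trans (SL.mult-¬Odd ¬odd x≢e) (sym (SM.mult-¬Odd ¬odd x≢e))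

module C₁Structure {n μ} (μ-partition : IsPartition n μ) {p} (triple : mult p μ ≡ 3)
  (others : All (λ q → q ≡ p ⊎ mult q μ ≡ 1) μ) where

  m : ℕ
  m = oddPart p

  a : ℕ
  a = ν₂ p

  μ⁻ : List ℕ
  μ⁻ = remove p (remove p μ)

  p∈μ : 1 ≤ mult p μ
  p∈μ = subst (1 ≤_) (sym triple) (s≤s z≤n)

  private
    μ>0 : All (1 ≤_) μ
    μ>0 = partition-parts>0 μ-partition

    p∈μ-removed : 1 ≤ mult p (remove p μ)
    p∈μ-removed = subst (1 ≤_) (suc-injective (trans (sym triple) once-removed)) (s≤s z≤n)
      where
      once-removed : mult p μ ≡ suc (mult p (remove p μ))
      once-removed = trans (mult-↭ p (↭.↭-sym (remove-↭ p μ p∈μ))) (mult-∷-self p _)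

  μ⁻↭μ : p ∷ p ∷ μ⁻ ↭ μ
  μ⁻↭μ = ↭.trans (↭.prep p (remove-↭ p (remove p μ) p∈μ-removed)) (remove-↭ p μ p∈μ)

  mult-μ : ∀ x → mult x μ ≡ δ p x + (δ p x + mult x μ⁻)
  mult-μ x = trans (sym (mult-↭ x μ⁻↭μ)) (trans (mult-∷ x p _) (cong (δ p x +_) (mult-∷ x p μ⁻)))

  units-μ : ∀ o → units o μ ≡ partUnits o p + (partUnits o p + units o μ⁻)
  units-μ o = sym (sum-map-↭ (partUnits o) μ⁻↭μ)

  1≤p : 1 ≤ p
  1≤p = lookup-mult μ>0 p∈μ

  m-odd : Odd m
  m-odd = oddPart-odd 1≤p

  p≡m*2^a : p ≡ m * 2 ^ a
  p≡m*2^a = class-form 1≤p refl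

  mult-μ⁻-p : mult p μ⁻ ≡ 1
  mult-μ⁻-p = suc-injective (suc-injective (begin
    2 + mult p μ⁻                   ≡⟨ cong (λ d → d + (d + mult p μ⁻)) (δ-refl p) ⟨
    δ p p + (δ p p + mult p μ⁻)     ≡⟨ mult-μ p ⟨
    mult p μ                        ≡⟨ triple ⟩
    3                               ∎))
    where open ≡-Reasoning

  mult-μ⁻≤1 : ∀ x → mult x μ⁻ ≤ 1
  mult-μ⁻≤1 x with x ≟ p
  ... | yes refl = ≤-reflexive mult-μ⁻-p
  ... | no  x≢p  = subst (_≤ 1) mult-μ≡mult-μ⁻ mult-μ≤1
    where
    mult-μ≡mult-μ⁻ : mult x μ ≡ mult x μ⁻
    mult-μ≡mult-μ⁻ = trans (mult-μ x) (cong (λ d → d + (d + mult x μ⁻)) (δ-≢ (x≢p ∘ sym)))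
    mult-μ≤1 : mult x μ ≤ 1
    mult-μ≤1 with mult x μ in mult≡
    ... | zero  = z≤n
    ... | suc _ with lookup-mult {x = x} others (subst (1 ≤_) (sym mult≡) (s≤s z≤n))
    ...   | inj₁ x≡p  = contradiction x≡p x≢p
    ...   | inj₂ once = ≤-reflexive (trans (sym mult≡) once)

  μ⁻-strict : AllPairs _>_ μ⁻
  μ⁻-strict = strictly-decreasing (remove-AllPairs p (remove-AllPairs p (Linked⇒decreasing (proj₁ μ-partition)))) mult-μ⁻≤1

  μ⁻>0 : All (1 ≤_) μ⁻
  μ⁻>0 = remove-All p (remove-All p μ>0)

  N : ℕ
  N = units m μ⁻

  units-m : units m μ ≡ N + 2 ^ suc a
  units-m = begin
    units m μ                                      ≡⟨ units-μ m ⟩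
    partUnits m p + (partUnits m p + N)            ≡⟨ cong (λ u → u + (u + N)) (partUnits-in-class p refl) ⟩
    2 ^ a + (2 ^ a + N)                            ≡⟨ rearrange (2 ^ a) N ⟩
    N + 2 * 2 ^ a                                  ∎
    where
    open ≡-Reasoning
    rearrange : ∀ u v → u + (u + v) ≡ v + 2 * u
    rearrange = solve-∀

  bit-N : bit a N ≡ 1
  bit-N = trans (bit-units μ⁻-strict μ⁻>0 m-odd a) (trans (cong (λ z → mult z μ⁻) (sym p≡m*2^a)) mult-μ⁻-p)

  profile : ∀ {x} → 1 ≤ x →
    mult x μ ≡ δ p x + (δ p x + bit (ν₂ x) (units (oddPart x) μ ∸ (partUnits (oddPart x) p + partUnits (oddPart x) p)))
  profile {x} 1≤x = trans (mult-μ x) (cong (λ z → δ p x + (δ p x + z)) (begin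
    mult x μ⁻                                         ≡⟨ cong (λ z → mult z μ⁻) (oddPart*2^ν₂ 1≤x) ⟨
    mult (o * 2 ^ ν₂ x) μ⁻                            ≡⟨ bit-units μ⁻-strict μ⁻>0 (oddPart-odd 1≤x) (ν₂ x) ⟨
    bit (ν₂ x) (units o μ⁻)                           ≡⟨ cong (bit (ν₂ x)) (m+n∸m≡n (u + u) (units o μ⁻)) ⟨
    bit (ν₂ x) (u + u + units o μ⁻ ∸ (u + u))         ≡⟨ cong (λ z → bit (ν₂ x) (z ∸ (u + u))) (trans (+-assoc u u _) (sym (units-μ o))) ⟩
    bit (ν₂ x) (units o μ ∸ (u + u))                  ∎))
    where
    open ≡-Reasoning
    o = oddPart x
    u = partUnits o p

C₁-determined : ∀ {n μ μ′} → IsPartition n μ → IsPartition n μ′ →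
  (c : C₁ μ) (c′ : C₁ μ′) → proj₁ c ≡ proj₁ c′ →
  (∀ o → Odd o → units o μ ≡ units o μ′) → ∀ x → 1 ≤ x → mult x μ ≡ mult x μ′
C₁-determined μ-partition μ′-partition (p , triple , others) (_ , triple′ , others′) refl same x 1≤x =
  trans (C₁Structure.profile μ-partition triple others 1≤x)
    (trans (cong (λ U → δ p x + (δ p x + bit (ν₂ x) (U ∸ (u + u)))) (same (oddPart x) (oddPart-odd 1≤x)))
      (sym (C₁Structure.profile μ′-partition triple′ others′ 1≤x)))
  where u = partUnits (oddPart x) p

module ToC₁ {n L} (L-partition : IsPartition n L) {k m} (k≥1 : 1 ≤ k) (m-odd : Odd m)
  (parts : All (λ q → Odd q ⊎ q ≡ 2 ^ k * m) L) (j-odd : Odd (mult (2 ^ k * m) L))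
  (c≥1 : 1 ≤ mult m L) (c≤ : mult m L ≤ 2 ^ k ∸ 1) where

  open A₁Structure k≥1 m-odd parts

  c<2^k : mult m L < 2 ^ k
  c<2^k = ≤∸1⇒< (2^>0 k) c≤

  c : ℕ
  c = mult m L

  j : ℕ
  j = mult e L

  a : ℕ
  a = proj₁ (magnitude c c≥1)

  c-magnitude : 2 ^ a ≤ c × c < 2 ^ suc a
  c-magnitude = proj₂ (magnitude c c≥1)

  d : ℕ
  d = k ∸ suc a

  k≡1+a+d : k ≡ suc a + d
  k≡1+a+d = sym (m+[n∸m]≡n (2^-cancel-< (≤-<-trans (proj₁ c-magnitude) c<2^k)))

  Q : ℕ
  Q = 2 ^ d * j

  units-m≡c+2^[1+a]*Q : units m L ≡ c + 2 ^ suc a * Q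
  units-m≡c+2^[1+a]*Q = begin
    units m L                     ≡⟨ units-m ⟩
    c + 2 ^ k * j                 ≡⟨ cong (λ i → c + 2 ^ i * j) k≡1+a+d ⟩
    c + 2 ^ (suc a + d) * j       ≡⟨ cong (λ z → c + z * j) (^-distribˡ-+-* 2 (suc a) d) ⟩
    c + 2 ^ suc a * 2 ^ d * j     ≡⟨ cong (c +_) (*-assoc (2 ^ suc a) (2 ^ d) j) ⟩
    c + 2 ^ suc a * Q             ∎
    where open ≡-Reasoning

  instance
    Q≢0 : NonZero Q
    Q≢0 = >-nonZero (*-mono-≤ (2^>0 d) (Odd⇒1≤ j-odd))

  N : ℕ
  N = c + 2 ^ suc a * pred Q

  N+2^[1+a]≡units-m : N + 2 ^ suc a ≡ units m L
  N+2^[1+a]≡units-m = begin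
    c + 2 ^ suc a * pred Q + 2 ^ suc a  ≡⟨ rearrange c (2 ^ suc a) (pred Q) ⟩
    c + 2 ^ suc a * suc (pred Q)        ≡⟨ cong (λ q → c + 2 ^ suc a * q) (suc-pred Q) ⟩
    c + 2 ^ suc a * Q                   ≡⟨ units-m≡c+2^[1+a]*Q ⟨
    units m L                           ∎
    where
    open ≡-Reasoning
    rearrange : ∀ c u q → c + u * q + u ≡ c + u * (1 + q)
    rearrange = solve-∀

  bit-N : bit a N ≡ 1
  bit-N = trans (bit-[r+2^suc[i]*q] a c (pred Q)) (bit-leading {a} (proj₁ c-magnitude) (proj₂ c-magnitude))

  p : ℕ
  p = m * 2 ^ a

  p-class : InClass m p
  p-class = Odd-*2^⇒1≤ m a m-odd , oddPart-*2^ m a m-odd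

  family : ℕ → List ℕ
  family o with o ≟ m
  ... | yes _ = binaryExpansion m N ++ p ∷ p ∷ []
  ... | no  _ = binaryExpansion o (units o L)

  family-m : family m ≡ binaryExpansion m N ++ p ∷ p ∷ []
  family-m with m ≟ m
  ... | yes _   = refl
  ... | no  m≢m = contradiction refl m≢m

  family-≢m : ∀ {o} → o ≢ m → family o ≡ binaryExpansion o (units o L)
  family-≢m {o} o≢m with o ≟ m
  ... | yes o≡m = contradiction o≡m o≢m
  ... | no  _   = refl

  family-class : ∀ o → All (InClass o) (family o)
  family-class o with o ≟ m | Odd? o
  ... | yes refl | _         = All-++⁺ (binaryExpansion-class m N m-odd) (p-class ∷ p-class ∷ [])
  ... | no _     | yes o-odd = binaryExpansion-class o (units o L) o-odd
  ... | no _     | no ¬odd   = subst (λ U → All (InClass o) (binaryExpansion o U))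
                                 (sym (units-¬Odd ¬odd (partition-parts>0 L-partition))) []

  family-units : ∀ o → Odd o → units o (family o) ≡ units o L
  family-units o o-odd with o ≟ m
  ... | no  _    = units-binaryExpansion o (units o L) o-odd
  ... | yes refl = begin
    units m (binaryExpansion m N ++ p ∷ p ∷ [])
      ≡⟨ sum-map-++ (partUnits m) (binaryExpansion m N) (p ∷ p ∷ []) ⟩
    units m (binaryExpansion m N) + units m (p ∷ p ∷ [])
      ≡⟨ cong₂ (λ U u → U + (u + (u + 0))) (units-binaryExpansion m N m-odd) (partUnits-*2^ m a m-odd) ⟩
    N + 2 ^ suc a
      ≡⟨ N+2^[1+a]≡units-m ⟩
    units m L
      ∎
    where open ≡-Reasoning

  open Regroup L-partition family family-class family-units public

  m≤n : m ≤ n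
  m≤n = lookup-mult (partition-parts≤ L-partition) c≥1

  mult-R-in-m : ∀ {x} → 1 ≤ x → oddPart x ≡ m → mult x R ≡ bit (ν₂ x) N + (δ p x + (δ p x + 0))
  mult-R-in-m {x} 1≤x x∈m = begin
    mult x R                                                   ≡⟨ mult-R 1≤x (subst (_≤ n) (sym x∈m) m≤n) ⟩
    mult x (family (oddPart x))                                ≡⟨ cong (λ o → mult x (family o)) x∈m ⟩
    mult x (family m)                                          ≡⟨ cong (mult x) family-m ⟩
    mult x (binaryExpansion m N ++ p ∷ p ∷ [])                 ≡⟨ mult-++ x (binaryExpansion m N) (p ∷ p ∷ []) ⟩
    mult x (binaryExpansion m N) + mult x (p ∷ p ∷ [])         ≡⟨ cong₂ _+_ binary-digit pair ⟩
    bit (ν₂ x) N + (δ p x + (δ p x + 0))                       ∎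
    where
    open ≡-Reasoning
    binary-digit : mult x (binaryExpansion m N) ≡ bit (ν₂ x) N
    binary-digit = trans (cong (λ z → mult z (binaryExpansion m N)) (class-form 1≤x x∈m)) (mult-binaryExpansion m N (ν₂ x) m-odd)
    pair : mult x (p ∷ p ∷ []) ≡ δ p x + (δ p x + 0)
    pair = trans (mult-∷ x p _) (cong (δ p x +_) (mult-∷ x p []))

  mult-R-out-m : ∀ {x} → 1 ≤ x → oddPart x ≢ m → oddPart x ≤ n → mult x R ≡ bit (ν₂ x) (units (oddPart x) L)
  mult-R-out-m {x} 1≤x x∉m oddPart≤n = begin
    mult x R                                                   ≡⟨ mult-R 1≤x oddPart≤n ⟩
    mult x (family o)                                          ≡⟨ cong (mult x) (family-≢m x∉m) ⟩
    mult x (binaryExpansion o (units o L))                     ≡⟨ cong (λ z → mult z (binaryExpansion o (units o L))) (class-form 1≤x refl) ⟩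
    mult (o * 2 ^ ν₂ x) (binaryExpansion o (units o L))        ≡⟨ mult-binaryExpansion o (units o L) (ν₂ x) (oddPart-odd 1≤x) ⟩
    bit (ν₂ x) (units o L)                                     ∎
    where
    open ≡-Reasoning
    o = oddPart x

  mult-R-p : mult p R ≡ 3
  mult-R-p = begin
    mult p R                               ≡⟨ mult-R-in-m (proj₁ p-class) (proj₂ p-class) ⟩
    bit (ν₂ p) N + (δ p p + (δ p p + 0))   ≡⟨ cong₂ (λ i d → bit i N + (d + (d + 0))) (ν₂-*2^ m a m-odd) (δ-refl p) ⟩
    bit a N + 2                            ≡⟨ cong (_+ 2) bit-N ⟩
    3                                      ∎
    where open ≡-Reasoning

  mult-R≤1 : ∀ {x} → 1 ≤ x → x ≤ n → x ≢ p → mult x R ≤ 1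
  mult-R≤1 {x} 1≤x x≤n x≢p with oddPart x ≟ m
  ... | yes x∈m = subst (_≤ 1) (sym mult≡bit) (bit≤1 (ν₂ x) N)
    where
    mult≡bit : mult x R ≡ bit (ν₂ x) N
    mult≡bit = trans (mult-R-in-m 1≤x x∈m)
      (trans (cong (λ d → bit (ν₂ x) N + (d + (d + 0))) (δ-≢ (x≢p ∘ sym))) (+-identityʳ _))
  ... | no  x∉m = subst (_≤ 1) (sym (mult-R-out-m 1≤x x∉m (≤-trans (oddPart≤ 1≤x) x≤n))) (bit≤1 (ν₂ x) _)

  R-others : All (λ q → q ≡ p ⊎ mult q R ≡ 1) R
  R-others = mult⇒All R occurs
    where
    occurs : ∀ x → 1 ≤ mult x R → x ≡ p ⊎ mult x R ≡ 1
    occurs x x∈R with x ≟ p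
    ... | yes x≡p = inj₁ x≡p
    ... | no  x≢p = inj₂ (≤-antisym (mult-R≤1 (lookup-mult (partition-parts>0 R-partition) x∈R)
                                              (lookup-mult (partition-parts≤ R-partition) x∈R) x≢p) x∈R)

  R-C₁ : C₁ R
  R-C₁ = p , mult-R-p , R-others

module ToA₁ {n μ} (μ-partition : IsPartition n μ) {p} (triple : mult p μ ≡ 3)
  (others : All (λ q → q ≡ p ⊎ mult q μ ≡ 1) μ) where

  open C₁Structure μ-partition triple others public

  -- Local: a global instance for NonZero (2 ^ i) would make instance search for NonZero 2 ambiguous.
  private instance
    2^[1+a]≢0 : NonZero (2 ^ suc a)
    2^[1+a]≢0 = m^n≢0 2 (suc a)

  T : ℕ
  T = units m μ

  c : ℕ
  c = T % 2 ^ suc a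

  Q : ℕ
  Q = T / 2 ^ suc a

  T≡c+2^[1+a]*Q : T ≡ c + 2 ^ suc a * Q
  T≡c+2^[1+a]*Q = trans (m≡m%n+[m/n]*n T (2 ^ suc a)) (cong (c +_) (*-comm Q (2 ^ suc a)))

  c<2^[1+a] : c < 2 ^ suc a
  c<2^[1+a] = m%n<n T (2 ^ suc a)

  2^a≤c : 2 ^ a ≤ c
  2^a≤c = ≮⇒≥ (λ c<2^a → 0≢1+n (trans (sym (bit-< a c<2^a)) bit-a-c))
    where
    open ≡-Reasoning
    bit-a-c : bit a c ≡ 1
    bit-a-c = begin
      bit a c                          ≡⟨ bit-[r+2^suc[i]*q] a c Q ⟨
      bit a (c + 2 ^ suc a * Q)        ≡⟨ cong (bit a) T≡c+2^[1+a]*Q ⟨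
      bit a T                          ≡⟨ cong (bit a) (trans units-m (cong (N +_) (sym (*-identityʳ (2 ^ suc a))))) ⟩
      bit a (N + 2 ^ suc a * 1)        ≡⟨ bit-[r+2^suc[i]*q] a N 1 ⟩
      bit a N                          ≡⟨ bit-N ⟩
      1                                ∎

  1≤Q : 1 ≤ Q
  1≤Q = m≥n⇒m/n>0 (subst (2 ^ suc a ≤_) (sym units-m) (m≤n+m (2 ^ suc a) N))

  k : ℕ
  k = suc a + ν₂ Q

  j : ℕ
  j = oddPart Q

  j-odd : Odd j
  j-odd = oddPart-odd 1≤Q

  e : ℕ
  e = 2 ^ k * m

  T≡c+j*2^k : T ≡ c + j * 2 ^ k
  T≡c+j*2^k = begin
    T                                   ≡⟨ T≡c+2^[1+a]*Q ⟩
    c + 2 ^ suc a * Q                   ≡⟨ cong (λ q → c + 2 ^ suc a * q) (class-form 1≤Q refl) ⟩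
    c + 2 ^ suc a * (j * 2 ^ ν₂ Q)      ≡⟨ cong (c +_) (reorder (2 ^ suc a) j (2 ^ ν₂ Q)) ⟩
    c + j * (2 ^ suc a * 2 ^ ν₂ Q)      ≡⟨ cong (λ z → c + j * z) (^-distribˡ-+-* 2 (suc a) (ν₂ Q)) ⟨
    c + j * 2 ^ k                       ∎
    where
    open ≡-Reasoning
    reorder : ∀ x y z → x * (y * z) ≡ y * (x * z)
    reorder = solve-∀

  e≡m*2^k : e ≡ m * 2 ^ k
  e≡m*2^k = *-comm (2 ^ k) m

  m-class : InClass m m
  m-class = Odd⇒1≤ m-odd , oddPart-of-odd m m-odd

  e-class : InClass m e
  e-class = subst (InClass m) (sym e≡m*2^k) (Odd-*2^⇒1≤ m k m-odd , oddPart-*2^ m k m-odd)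

  family : ℕ → List ℕ
  family o with o ≟ m
  ... | yes _ = replicate c m ++ replicate j e
  ... | no  _ = replicate (units o μ) o

  family-m : family m ≡ replicate c m ++ replicate j e
  family-m with m ≟ m
  ... | yes _   = refl
  ... | no  m≢m = contradiction refl m≢m

  family-class : ∀ o → All (InClass o) (family o)
  family-class o with o ≟ m | Odd? o
  ... | yes refl | _         = All-++⁺ (All-replicate⁺ c m-class) (All-replicate⁺ j e-class)
  ... | no _     | yes o-odd = All-replicate⁺ (units o μ) (Odd⇒1≤ o-odd , oddPart-of-odd o o-odd)
  ... | no _     | no ¬odd   = subst (λ u → All (InClass o) (replicate u o))
                                 (sym (units-¬Odd ¬odd (partition-parts>0 μ-partition))) []

  family-parts : ∀ o → All (λ q → Odd q ⊎ q ≡ e) (family o)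
  family-parts o with o ≟ m | Odd? o
  ... | yes refl | _         = All-++⁺ (All-replicate⁺ c (inj₁ m-odd)) (All-replicate⁺ j (inj₂ refl))
  ... | no _     | yes o-odd = All-replicate⁺ (units o μ) (inj₁ o-odd)
  ... | no _     | no ¬odd   = subst (λ u → All _ (replicate u o))
                                 (sym (units-¬Odd ¬odd (partition-parts>0 μ-partition))) []

  family-units : ∀ o → Odd o → units o (family o) ≡ units o μ
  family-units o o-odd with o ≟ m
  ... | no  _    = trans (sum-map-replicate (partUnits o) (units o μ) o)
                     (trans (cong (units o μ *_) (trans (partUnits-odd o o o-odd) (δ-refl o))) (*-identityʳ _))
  ... | yes refl = begin
    units m (replicate c m ++ replicate j e)           ≡⟨ sum-map-++ (partUnits m) (replicate c m) (replicate j e) ⟩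
    units m (replicate c m) + units m (replicate j e)  ≡⟨ cong₂ _+_ (sum-map-replicate (partUnits m) c m)
                                                                    (sum-map-replicate (partUnits m) j e) ⟩
    c * partUnits m m + j * partUnits m e              ≡⟨ cong₂ (λ u v → c * u + j * v) units-m-m units-m-e ⟩
    c * 1 + j * 2 ^ k                                  ≡⟨ cong (_+ j * 2 ^ k) (*-identityʳ c) ⟩
    c + j * 2 ^ k                                      ≡⟨ T≡c+j*2^k ⟨
    T                                                  ∎
    where
    open ≡-Reasoning
    units-m-m : partUnits m m ≡ 1
    units-m-m = trans (partUnits-odd m m m-odd) (δ-refl m)
    units-m-e : partUnits m e ≡ 2 ^ k
    units-m-e = trans (cong (partUnits m) e≡m*2^k) (partUnits-*2^ m k m-odd)

  open Regroup μ-partition family family-class family-units public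

  m≤n : m ≤ n
  m≤n = ≤-trans (oddPart≤ 1≤p) (lookup-mult (partition-parts≤ μ-partition) p∈μ)

  mult-R-class-m : ∀ {x} → InClass m x → mult x R ≡ c * δ m x + j * δ e x
  mult-R-class-m {x} (1≤x , x∈m) = begin
    mult x R                                          ≡⟨ mult-R 1≤x (subst (_≤ n) (sym x∈m) m≤n) ⟩
    mult x (family (oddPart x))                       ≡⟨ cong (λ o → mult x (family o)) x∈m ⟩
    mult x (family m)                                 ≡⟨ cong (mult x) family-m ⟩
    mult x (replicate c m ++ replicate j e)           ≡⟨ mult-++ x (replicate c m) (replicate j e) ⟩
    mult x (replicate c m) + mult x (replicate j e)   ≡⟨ cong₂ _+_ (mult-replicate x c m) (mult-replicate x j e) ⟩
    c * δ m x + j * δ e x                             ∎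
    where open ≡-Reasoning

  m≢e : m ≢ e
  m≢e m≡e = ¬Odd-2^* {k} m (s≤s z≤n) (subst Odd m≡e m-odd)

  mult-R-m : mult m R ≡ c
  mult-R-m = begin
    mult m R               ≡⟨ mult-R-class-m m-class ⟩
    c * δ m m + j * δ e m  ≡⟨ cong₂ (λ d d′ → c * d + j * d′) (δ-refl m) (δ-≢ (m≢e ∘ sym)) ⟩
    c * 1 + j * 0          ≡⟨ cong₂ _+_ (*-identityʳ c) (*-zeroʳ j) ⟩
    c + 0                  ≡⟨ +-identityʳ c ⟩
    c                      ∎
    where open ≡-Reasoning

  mult-R-e : mult e R ≡ j
  mult-R-e = begin
    mult e R               ≡⟨ mult-R-class-m e-class ⟩
    c * δ m e + j * δ e e  ≡⟨ cong₂ (λ d d′ → c * d + j * d′) (δ-≢ m≢e) (δ-refl e) ⟩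
    c * 0 + j * 1          ≡⟨ cong (_+ j * 1) (*-zeroʳ c) ⟩
    j * 1                  ≡⟨ *-identityʳ j ⟩
    j                      ∎
    where open ≡-Reasoning

  k≥1 : 1 ≤ k
  k≥1 = s≤s z≤n

  R-parts : All (λ q → Odd q ⊎ q ≡ e) R
  R-parts = All-R family-parts

  R-j-odd : Odd (mult e R)
  R-j-odd = subst Odd (sym mult-R-e) j-odd

  R-c≥1 : 1 ≤ mult m R
  R-c≥1 = subst (1 ≤_) (sym mult-R-m) (≤-trans (2^>0 a) 2^a≤c)

  R-c≤ : mult m R ≤ 2 ^ k ∸ 1
  R-c≤ = subst (_≤ 2 ^ k ∸ 1) (sym mult-R-m) (<⇒≤∸1 (<-≤-trans c<2^[1+a] (2^-mono-≤ (m≤m+n (suc a) (ν₂ Q)))))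

  R-A₁ : A₁ R
  R-A₁ = k , m , k≥1 , m-odd , R-parts , R-j-odd , R-c≥1 , R-c≤

IsPartition-irrelevant : ∀ {n L} (u v : IsPartition n L) → u ≡ v
IsPartition-irrelevant (L↓ , L>0 , sum≡) (L↓′ , L>0′ , sum≡′) = cong₂ _,_ (Linked.irrelevant ≤-irrelevant L↓ L↓′)
  (cong₂ _,_ (All.irrelevant ≤-irrelevant L>0 L>0′) (≡-irrelevant sum≡ sum≡′))

⊎-irrelevant : ∀ {A B : Set} → (∀ (x y : A) → x ≡ y) → (∀ (x y : B) → x ≡ y) → ¬ (A × B) →
  ∀ (x y : A ⊎ B) → x ≡ y
⊎-irrelevant A-irr B-irr disjoint (inj₁ x) (inj₁ y) = cong inj₁ (A-irr x y)
⊎-irrelevant A-irr B-irr disjoint (inj₂ x) (inj₂ y) = cong inj₂ (B-irr x y)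
⊎-irrelevant A-irr B-irr disjoint (inj₁ x) (inj₂ y) = contradiction (x , y) disjoint
⊎-irrelevant A-irr B-irr disjoint (inj₂ x) (inj₁ y) = contradiction (y , x) disjoint

A₁-parameters-unique : ∀ {L} (a b : A₁ L) → A₁-parameters a ≡ A₁-parameters b
A₁-parameters-unique (k , m , k≥1 , m-odd , _ , j-odd , _) (k′ , m′ , _ , m′-odd , parts′ , _)
  with lookup-mult parts′ (Odd⇒1≤ j-odd)
... | inj₁ e-odd = contradiction e-odd (¬Odd-2^* m k≥1)
... | inj₂ e≡e′  = cong₂ _,_ (proj₂ same) (proj₁ same)
  where
  same = *2^-injective {m} {m′} k k′ m-odd m′-odd (trans (*-comm m (2 ^ k)) (trans e≡e′ (*-comm (2 ^ k′) m′)))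

A₁-irrelevant : ∀ {L} (a b : A₁ L) → a ≡ b
A₁-irrelevant a b = with-parameters a b (A₁-parameters-unique a b)
  where
  with-parameters : ∀ {L} (a b : A₁ L) → A₁-parameters a ≡ A₁-parameters b → a ≡ b
  with-parameters (k , m , k≥1 , m-odd , parts , j-odd , c≥1 , c≤)
                  (_ , _ , k≥1′ , m-odd′ , parts′ , j-odd′ , c≥1′ , c≤′) refl =
    cong (λ rest → k , m , rest)
      (cong₂ _,_ (≤-irrelevant k≥1 k≥1′) (cong₂ _,_ (≡-irrelevant m-odd m-odd′)
      (cong₂ _,_ (All.irrelevant part-irrelevant parts parts′) (cong₂ _,_ (≡-irrelevant j-odd j-odd′)
      (cong₂ _,_ (≤-irrelevant c≥1 c≥1′) (≤-irrelevant c≤ c≤′))))))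
    where
    part-irrelevant : ∀ {q} (x y : Odd q ⊎ q ≡ 2 ^ k * m) → x ≡ y
    part-irrelevant = ⊎-irrelevant ≡-irrelevant ≡-irrelevant (λ { (q-odd , refl) → ¬Odd-2^* m k≥1 q-odd })

C₁-irrelevant : ∀ {L} (a b : C₁ L) → a ≡ b
C₁-irrelevant {L} (p , triple , others) (p′ , triple′ , others′)
  with lookup-mult others (subst (1 ≤_) (sym triple′) (s≤s z≤n))
... | inj₂ once = contradiction (trans (sym triple′) once) λ ()
... | inj₁ refl = cong (p ,_) (cong₂ _,_ (≡-irrelevant triple triple′) (All.irrelevant choice-irrelevant others others′))
  where
  choice-irrelevant : ∀ {q} (x y : q ≡ p ⊎ mult q L ≡ 1) → x ≡ y
  choice-irrelevant = ⊎-irrelevant ≡-irrelevant ≡-irrelevant (λ { (refl , once) → contradiction (trans (sym triple) once) λ () })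

A₁-Partitions-≡ : ∀ {n} (x y : A₁-Partitions n) → proj₁ x ≡ proj₁ y → x ≡ y
A₁-Partitions-≡ (L , u , a) (_ , v , b) refl = cong (L ,_) (cong₂ _,_ (IsPartition-irrelevant u v) (A₁-irrelevant a b))

C₁-Partitions-≡ : ∀ {n} (x y : C₁-Partitions n) → proj₁ x ≡ proj₁ y → x ≡ y
C₁-Partitions-≡ (L , u , a) (_ , v , b) refl = cong (L ,_) (cong₂ _,_ (IsPartition-irrelevant u v) (C₁-irrelevant a b))

toC₁ : ∀ {n} → A₁-Partitions n → C₁-Partitions n
toC₁ (L , L-partition , k , m , k≥1 , m-odd , parts , j-odd , c≥1 , c≤) = R , R-partition , R-C₁
  where open ToC₁ L-partition k≥1 m-odd parts j-odd c≥1 c≤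

toA₁ : ∀ {n} → C₁-Partitions n → A₁-Partitions n
toA₁ (μ , μ-partition , p , triple , others) = R , R-partition , R-A₁
  where open ToA₁ μ-partition triple others

toA₁∘toC₁ : ∀ {n} (x : A₁-Partitions n) → toA₁ (toC₁ x) ≡ x
toA₁∘toC₁ x@(L , L-partition , A@(k , m , k≥1 , m-odd , parts , j-odd , c≥1 , c≤)) =
  A₁-Partitions-≡ (toA₁ (toC₁ x)) x
    (partition-≡ B.R-partition L-partition (λ y _ → A₁-determined B.R-A₁ A parameters units-preserved y))
  where
  module F = ToC₁ L-partition k≥1 m-odd parts j-odd c≥1 c≤
  module B = ToA₁ F.R-partition F.mult-R-p F.R-others

  units-preserved : ∀ o → Odd o → units o B.R ≡ units o L
  units-preserved o odd = trans (B.units-R o odd) (F.units-R o odd)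

  m≡ : B.m ≡ m
  m≡ = oddPart-*2^ m F.a m-odd

  a≡ : B.a ≡ F.a
  a≡ = ν₂-*2^ m F.a m-odd

  Q≡ : B.Q ≡ F.Q
  Q≡ = proj₂ (divMod-unique (subst (λ i → B.c < 2 ^ suc i) a≡ B.c<2^[1+a]) (proj₂ F.c-magnitude) (begin
    B.c + 2 ^ suc F.a * B.Q   ≡⟨ cong (λ i → B.c + 2 ^ suc i * B.Q) a≡ ⟨
    B.c + 2 ^ suc B.a * B.Q   ≡⟨ B.T≡c+2^[1+a]*Q ⟨
    units B.m F.R             ≡⟨ cong (λ o → units o F.R) m≡ ⟩
    units m F.R               ≡⟨ F.units-R m m-odd ⟩
    units m L                 ≡⟨ F.units-m≡c+2^[1+a]*Q ⟩
    F.c + 2 ^ suc F.a * F.Q   ∎))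
    where open ≡-Reasoning

  k≡ : B.k ≡ k
  k≡ = begin
    suc B.a + ν₂ B.Q          ≡⟨ cong₂ (λ i q → suc i + ν₂ q) a≡ Q≡ ⟩
    suc F.a + ν₂ (2 ^ F.d * F.j) ≡⟨ cong (λ q → suc F.a + ν₂ q) (*-comm (2 ^ F.d) F.j) ⟩
    suc F.a + ν₂ (F.j * 2 ^ F.d) ≡⟨ cong (suc F.a +_) (ν₂-*2^ F.j F.d j-odd) ⟩
    suc F.a + F.d              ≡⟨ F.k≡1+a+d ⟨
    k                          ∎
    where open ≡-Reasoning

  parameters : A₁-parameters B.R-A₁ ≡ A₁-parameters A
  parameters = cong₂ _,_ k≡ m≡

toC₁∘toA₁ : ∀ {n} (y : C₁-Partitions n) → toC₁ (toA₁ y) ≡ y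
toC₁∘toA₁ y@(μ , μ-partition , C@(p , triple , others)) =
  C₁-Partitions-≡ (toC₁ (toA₁ y)) y
    (partition-≡ F.R-partition μ-partition (C₁-determined F.R-partition μ-partition F.R-C₁ C special-part units-preserved))
  where
  module B = ToA₁ μ-partition triple others
  module F = ToC₁ B.R-partition B.k≥1 B.m-odd B.R-parts B.R-j-odd B.R-c≥1 B.R-c≤

  units-preserved : ∀ o → Odd o → units o F.R ≡ units o μ
  units-preserved o odd = trans (F.units-R o odd) (B.units-R o odd)

  a≡ : F.a ≡ B.a
  a≡ = magnitude-unique (proj₁ F.c-magnitude) (proj₂ F.c-magnitude)
    (subst (2 ^ B.a ≤_) (sym B.mult-R-m) B.2^a≤c) (subst (_< 2 ^ suc B.a) (sym B.mult-R-m) B.c<2^[1+a])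

  special-part : F.p ≡ p
  special-part = trans (cong (B.m *_) (cong (2 ^_) a≡)) (sym B.p≡m*2^a)

-- The bijection exists for every n (both sides are empty when n = 0).
mainTheorem6 : (n : ℕ) → 1 ≤ n → A₁-Partitions n ↔ C₁-Partitions n
mainTheorem6 n _ = mk↔ₛ′ toC₁ toA₁ toC₁∘toA₁ toA₁∘toC₁
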